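{- Consider integers $n\ge 0$, $l\ge 1$ and $b$ with $2 \leq b \leq 10$. \begin{enumerate} \item The only solution $(n,b,l)$ of $\mathcal{P}_{n} = (b+1)b^l-1$ is $(7,2,1)$; thus the only Thabit number of the first kind base $b$ (for $2\le b\le 10$) which is a Padovan number is $5$. \item The solutions $(n,b,l)$ of $\mathcal{P}_{n} = (b+1)b^l+1$ are exactly $(8, 2, 1), (12, 4, 1), (14, 3, 2), (15, 2, 4), (19, 5, 2)$; thus the Thabit numbers of the second kind base $b$ which are Padovan numbers are $7, 21, 37, 49, 151$. \item The solutions $(n,b,l)$ of $\mathcal{P}_{n} = (b-1)b^l-1$ are exactly $(0, 2, 1), (1, 2, 1), (2, 2, 1), (5, 2, 2), (7, 3, 1), (8, 2, 3)$; thus the Williams numbers of the first kind base $b$ which are Padovan numbers are $1, 3, 5, 7$. \item The solutions $(n,b,l)$ of $\mathcal{P}_{n} = (b-1)b^l+1$ are exactly $(5, 2, 1), (7, 2, 2), (8, 3, 1), (9, 2, 3), (12, 5, 1), (15, 4, 2), (16, 2, 6), (26, 6, 3)$; thus the Williams numbers of the second kind base $b$ which are Padovan numbers are $3, 5, 7, 9, 21, 49, 65, 1081$. \end{enumerate}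
   Context: $(\mathcal{P}_n)_{n\ge 0}$ denotes the Padovan sequence: $\mathcal{P}_0=\mathcal{P}_1=\mathcal{P}_2=1$ and $\mathcal{P}_{n+3}=\mathcal{P}_{n+1}+\mathcal{P}_n$ for all $n\ge 0$. For an integer $b\ge 2$ and $l\ge 1$: a Thabit number of the first kind base $b$ is $(b+1)b^l-1$, of the second kind is $(b+1)b^l+1$; a Williams number of the first kind base $b$ is $(b-1)b^l-1$, of the second kind is $(b-1)b^l+1$. -}

module Defs where

open import Data.Nat using (ℕ; zero; suc; _+_; _*_; _∸_; _^_; _≤_)
open import Data.Product using (_×_)
open import Relation.Binary.PropositionalEquality using (_≡_)

padovan : ℕ → ℕ
padovan zero = 1
padovan (suc zero) = 1
padovan (suc (suc zero)) = 1
padovan (suc (suc (suc n))) = padovan (suc n) + padovan n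

-- Thabit numbers (first / second kind) and Williams numbers (first / second kind).
-- For b ≥ 2, l ≥ 1 the products are ≥ 2, so truncated subtraction ∸ is exact.
thabit₁ : ℕ → ℕ → ℕ
thabit₁ b l = (b + 1) * b ^ l ∸ 1

thabit₂ : ℕ → ℕ → ℕ
thabit₂ b l = (b + 1) * b ^ l + 1

williams₁ : ℕ → ℕ → ℕ
williams₁ b l = (b ∸ 1) * b ^ l ∸ 1

williams₂ : ℕ → ℕ → ℕ
williams₂ b l = (b ∸ 1) * b ^ l + 1

Is : ℕ → ℕ → ℕ → ℕ → ℕ → ℕ → Set
Is n b l x y z = (n ≡ x) × (b ≡ y) × (l ≡ z)

{-# OPTIONS --safe #-}
-- Each equation has the shape P n + A = c * b ^ l + D with A, D ∈ {0, 1}.  Exponents l below a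
-- threshold L are settled by listing the Padovan numbers up to the right-hand side, the sequence
-- being nondecreasing.  Exponents l ≥ L are excluded by a covering of congruences: P n mod M is
-- periodic in n, and for each residue it takes there is a divisor m of M modulo which it differs
-- from every value of c * b ^ l + D with l ≥ L, these values being periodic in l as well.  The
-- thresholds, moduli and periods come from a computer search and are checked by evaluation.
module Submission where

open import Data.Bool.Base using (true)
open import Data.Bool.ListAction using (all; any)
open import Data.Bool.Properties using (T-≡)
open import Data.List.Base as List using (List; []; _∷_; applyUpTo)
open import Data.List.Membership.Propositional.Properties using (∈-applyUpTo⁺)
open import Data.List.Relation.Unary.All as All using (All; []; _∷_; all?)
open import Data.List.Relation.Unary.All.Properties using (all⁺; all⁻)
open import Data.List.Relation.Unary.Any as Any using (Any; any?)
open import Data.List.Relation.Unary.Any.Properties using (any⁺; any⁻)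
open import Data.Nat.Base
open import Data.Nat.DivMod
open import Data.Nat.Divisibility using (_∣_; _∣?_)
open import Data.Nat.GeneralisedArithmetic using (iterate)
open import Data.Nat.Properties
open import Data.Product.Base using (_×_; _,_; proj₁; proj₂)
open import Data.Product.Properties using (≡-dec)
open import Data.Sum.Base using (_⊎_; inj₁; inj₂)
open import Function.Base using (id; _∘_)
open import Function.Bundles using (Equivalence)
open import Relation.Binary.Definitions using (DecidableEquality)
open import Relation.Binary.PropositionalEquality
open import Relation.Nullary.Decidable using (Dec; yes; no; isYes; toWitness; fromWitness; map′; T?; ¬?; _×-dec_; _⊎-dec_; _→-dec_)
open import Relation.Nullary.Negation using (¬_; contradiction)

open import Defs

iterate-+ : ∀ {A : Set} (f : A → A) x m n → iterate f x (m + n) ≡ iterate f (iterate f x m) n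
iterate-+ f x zero    n = refl
iterate-+ f x (suc m) n = iterate-+ f (f x) m n

iterate-fixed-* : ∀ {A : Set} (f : A → A) {x T} → iterate f x T ≡ x → ∀ q → iterate f x (q * T) ≡ x
iterate-fixed-* f         fix zero    = refl
iterate-fixed-* f {x} {T} fix (suc q) = begin
  iterate f x (T + q * T)            ≡⟨ iterate-+ f x T (q * T) ⟩
  iterate f (iterate f x T) (q * T)  ≡⟨ cong (λ y → iterate f y (q * T)) fix ⟩
  iterate f x (q * T)                ≡⟨ iterate-fixed-* f fix q ⟩
  x                                  ∎
  where open ≡-Reasoning

iterate-periodic : ∀ {A : Set} (f : A → A) {x} T .{{_ : NonZero T}} → iterate f x T ≡ x →
                   ∀ n → iterate f x n ≡ iterate f x (n % T)
iterate-periodic f {x} T fix n = begin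
  iterate f x n                                   ≡⟨ cong (iterate f x) n≡qT+r ⟩
  iterate f x (n / T * T + n % T)                 ≡⟨ iterate-+ f x (n / T * T) (n % T) ⟩
  iterate f (iterate f x (n / T * T)) (n % T)     ≡⟨ cong (λ y → iterate f y (n % T)) (iterate-fixed-* f fix (n / T)) ⟩
  iterate f x (n % T)                             ∎
  where
  open ≡-Reasoning
  n≡qT+r : n ≡ n / T * T + n % T
  n≡qT+r = trans (m≡m%n+[m/n]*n n T) (+-comm (n % T) (n / T * T))

lookup-iterate : ∀ {A : Set} {P : A → Set} (f : A → A) {x k} → All P (List.iterate f x k) →
                 ∀ {i} → i < k → P (iterate f x i)
lookup-iterate f {k = suc k} (px ∷ _)   {zero}  _         = px
lookup-iterate f {k = suc k} (_  ∷ pxs) {suc i} (s≤s i<k) = lookup-iterate f pxs i<k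

lookup-between : ∀ {P : ℕ → Set} {m k} .{{_ : NonZero k}} → All P (applyUpTo (m +_) k) →
                 ∀ {b} → m ≤ b → b < m + k → P b
lookup-between {P} {m} {k} ps {b} m≤b b<m+k = subst P (m+[n∸m]≡n m≤b) (All.lookup ps b∸m-listed)
  where
  b∸m-listed = ∈-applyUpTo⁺ (m +_) (m<n+o⇒m∸n<o b m b<m+k)

module _ (m : ℕ) .{{_ : NonZero m}} where

  %-cong-+ʳ : ∀ {x y} a → x % m ≡ y % m → (x + a) % m ≡ (y + a) % m
  %-cong-+ʳ {x} {y} a x≡y = begin
    (x + a) % m            ≡⟨ %-distribˡ-+ x a m ⟩
    (x % m + a % m) % m    ≡⟨ cong (λ z → (z + a % m) % m) x≡y ⟩
    (y % m + a % m) % m    ≡⟨ %-distribˡ-+ y a m ⟨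
    (y + a) % m            ∎
    where open ≡-Reasoning

  %-cong-*ˡ : ∀ a {x y} → x % m ≡ y % m → (a * x) % m ≡ (a * y) % m
  %-cong-*ˡ a {x} {y} x≡y = begin
    (a * x) % m            ≡⟨ %-distribˡ-* a x m ⟩
    (a % m * (x % m)) % m  ≡⟨ cong (λ z → (a % m * z) % m) x≡y ⟩
    (a % m * (y % m)) % m  ≡⟨ %-distribˡ-* a y m ⟨
    (a * y) % m            ∎
    where open ≡-Reasoning

  mulMod : ℕ → ℕ → ℕ
  mulMod b u = b * u % m

  iterate-mulMod : ∀ b L j → iterate (mulMod b) (b ^ L % m) j ≡ b ^ (j + L) % m
  iterate-mulMod b L zero    = refl
  iterate-mulMod b L (suc j) = begin
    iterate (mulMod b) (b * (b ^ L % m) % m) j  ≡⟨ cong (λ u → iterate (mulMod b) u j) (%-cong-*ˡ b (m%n%n≡m%n (b ^ L) m)) ⟩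
    iterate (mulMod b) (b ^ suc L % m) j        ≡⟨ iterate-mulMod b (suc L) j ⟩
    b ^ (j + suc L) % m                         ≡⟨ cong (λ e → b ^ e % m) (+-suc j L) ⟩
    b ^ suc (j + L) % m                         ∎
    where open ≡-Reasoning

  ^-%-periodic : ∀ b L O .{{_ : NonZero O}} → iterate (mulMod b) (b ^ L % m) O ≡ b ^ L % m →
                 ∀ {l} → L ≤ l → b ^ l % m ≡ iterate (mulMod b) (b ^ L % m) ((l ∸ L) % O)
  ^-%-periodic b L O period {l} L≤l = begin
    b ^ l % m                                          ≡⟨ cong (λ e → b ^ e % m) (m∸n+n≡m L≤l) ⟨
    b ^ (l ∸ L + L) % m                                ≡⟨ iterate-mulMod b L (l ∸ L) ⟨
    iterate (mulMod b) (b ^ L % m) (l ∸ L)             ≡⟨ iterate-periodic (mulMod b) O period (l ∸ L) ⟩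
    iterate (mulMod b) (b ^ L % m) ((l ∸ L) % O)       ∎
    where open ≡-Reasoning

Window : Set
Window = ℕ × ℕ × ℕ

_≟ʷ_ : DecidableEquality Window
_≟ʷ_ = ≡-dec _≟_ (≡-dec _≟_ _≟_)

padovanStep : (ℕ → ℕ) → Window → Window
padovanStep r (x , y , z) = y , z , r (y + x)

padovanWindow : (ℕ → ℕ) → ℕ → Window
padovanWindow r n = r (padovan n) , r (padovan (1 + n)) , r (padovan (2 + n))

iterate-padovanStep : (r : ℕ → ℕ) → (∀ x y → r (r x + r y) ≡ r (x + y)) →
                      ∀ n → iterate (padovanStep r) (padovanWindow r 0) n ≡ padovanWindow r n
iterate-padovanStep r r-+ = go 0
  where
  go : ∀ k n → iterate (padovanStep r) (padovanWindow r k) n ≡ padovanWindow r (k + n)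
  go k zero    = sym (cong (padovanWindow r) (+-identityʳ k))
  go k (suc n) = begin
    iterate (padovanStep r) (padovanStep r (padovanWindow r k)) n  ≡⟨ cong (λ w → iterate (padovanStep r) w n) step ⟩
    iterate (padovanStep r) (padovanWindow r (suc k)) n            ≡⟨ go (suc k) n ⟩
    padovanWindow r (suc k + n)                                    ≡⟨ cong (padovanWindow r) (+-suc k n) ⟨
    padovanWindow r (k + suc n)                                    ∎
    where
    open ≡-Reasoning
    step : padovanStep r (padovanWindow r k) ≡ padovanWindow r (suc k)
    step = cong (λ v → r (padovan (1 + k)) , r (padovan (2 + k)) , v) (r-+ (padovan (1 + k)) (padovan k))

-- Linear-time evaluation, whereas padovan recurses exponentially.
padovan′ : ℕ → ℕ
padovan′ n = proj₁ (iterate (padovanStep id) (padovanWindow id 0) n)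

padovan′≡padovan : ∀ n → padovan′ n ≡ padovan n
padovan′≡padovan n = cong proj₁ (iterate-padovanStep id (λ _ _ → refl) n)

padovan-%-periodic : ∀ M .{{_ : NonZero M}} T .{{_ : NonZero T}} →
  iterate (padovanStep (_% M)) (padovanWindow (_% M) 0) T ≡ padovanWindow (_% M) 0 →
  ∀ n → proj₁ (iterate (padovanStep (_% M)) (padovanWindow (_% M) 0) (n % T)) ≡ padovan n % M
padovan-%-periodic M T period n = cong proj₁ (begin
  iterate (padovanStep (_% M)) (padovanWindow (_% M) 0) (n % T)  ≡⟨ iterate-periodic (padovanStep (_% M)) T period n ⟨
  iterate (padovanStep (_% M)) (padovanWindow (_% M) 0) n        ≡⟨ iterate-padovanStep (_% M) %-+ n ⟩
  padovanWindow (_% M) n                                         ∎)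
  where
  open ≡-Reasoning
  %-+ : ∀ x y → (x % M + y % M) % M ≡ (x + y) % M
  %-+ x y = sym (%-distribˡ-+ x y M)

padovan-≤-suc : ∀ n → padovan n ≤ padovan (suc n)
padovan-≤-suc 0                   = ≤-refl
padovan-≤-suc 1                   = ≤-refl
padovan-≤-suc 2                   = s≤s z≤n
padovan-≤-suc (suc (suc (suc n))) = +-mono-≤ (padovan-≤-suc (suc n)) (padovan-≤-suc n)

padovan-mono-≤ : ∀ {m n} → m ≤ n → padovan m ≤ padovan n
padovan-mono-≤ {n = zero}  z≤n   = ≤-refl
padovan-mono-≤ {m} {suc n} m≤1+n with m≤n⇒m<n∨m≡n m≤1+n
... | inj₁ (s≤s m≤n) = ≤-trans (padovan-mono-≤ m≤n) (padovan-≤-suc n)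
... | inj₂ refl      = ≤-refl

-- m ↻ O: a modulus m with a period O of l ↦ b ^ l % m on l ≥ L (checked by Sieve.Valid).
record PeriodicModulus : Set where
  constructor _↻_
  field
    modulus : ℕ
    {{modulus≢0}} : NonZero modulus
    period : ℕ
    {{period≢0}} : NonZero period

module Sieve (A D c b L : ℕ) where

  Excludes : PeriodicModulus → ℕ → Set
  Excludes (m ↻ O) x = All (λ u → (x + A) % m ≢ (c * u + D) % m) (List.iterate (mulMod m b) (b ^ L % m) O)

  Valid : ℕ → PeriodicModulus → Set
  Valid M (m ↻ O) = m ∣ M × iterate (mulMod m b) (b ^ L % m) O ≡ b ^ L % m

  Covers : (M T : ℕ) .{{_ : NonZero M}} → List PeriodicModulus → Set
  Covers M T qs = All (λ w → Any (λ q → Excludes q (proj₁ w)) qs) (List.iterate (padovanStep (_% M)) (padovanWindow (_% M) 0) T)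

  Certificate : (M T : ℕ) .{{_ : NonZero M}} → List PeriodicModulus → Set
  Certificate M T qs =
    All (Valid M) qs ×
    iterate (padovanStep (_% M)) (padovanWindow (_% M) 0) T ≡ padovanWindow (_% M) 0 ×
    Covers M T qs

  excludes? : ∀ q x → Dec (Excludes q x)
  excludes? (m ↻ O) x = all? (λ u → ¬? ((x + A) % m ≟ (c * u + D) % m)) _

  valid? : ∀ M q → Dec (Valid M q)
  valid? M (m ↻ O) = (m ∣? M) ×-dec (iterate (mulMod m b) (b ^ L % m) O ≟ b ^ L % m)

  -- Decided by a Boolean traversal: evaluating all? and any? directly over orbits of up to 10⁵
  -- windows is about three times slower.
  covers? : ∀ M T .{{_ : NonZero M}} qs → Dec (Covers M T qs)
  covers? M T qs = map′ (All.map (Any.map toWitness ∘ any⁻ _ qs) ∘ all⁺ _ orbit)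
                        (all⁻ _ ∘ All.map (any⁺ _ ∘ Any.map fromWitness))
                        (T? (all (λ w → any (λ q → isYes (excludes? q (proj₁ w))) qs) orbit))
    where orbit = List.iterate (padovanStep (_% M)) (padovanWindow (_% M) 0) T

  certificate? : ∀ M T .{{_ : NonZero M}} qs → Dec (Certificate M T qs)
  certificate? M T qs =
    all? (valid? M) qs ×-dec
    (iterate (padovanStep (_% M)) (padovanWindow (_% M) 0) T ≟ʷ padovanWindow (_% M) 0) ×-dec
    covers? M T qs

  refuted : ∀ {M} .{{_ : NonZero M}} n {l} → L ≤ l → padovan n + A ≡ c * b ^ l + D →
            ∀ q → Valid M q → ¬ Excludes q (padovan n % M)
  refuted {M} n {l} L≤l eq (m ↻ O) (m∣M , period) excludes =
    lookup-iterate (mulMod m b) excludes (m%n<n (l ∸ L) O) residues-agree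
    where
    open ≡-Reasoning
    u = iterate (mulMod m b) (b ^ L % m) ((l ∸ L) % O)
    b^l≡u : b ^ l % m ≡ u % m
    b^l≡u = trans (sym (m%n%n≡m%n (b ^ l) m)) (cong (_% m) (^-%-periodic m b L O period L≤l))
    residues-agree : (padovan n % M + A) % m ≡ (c * u + D) % m
    residues-agree = begin
      (padovan n % M + A) % m  ≡⟨ %-cong-+ʳ m A (m∣n⇒o%n%m≡o%m m M (padovan n) m∣M) ⟩
      (padovan n + A) % m      ≡⟨ cong (_% m) eq ⟩
      (c * b ^ l + D) % m      ≡⟨ %-cong-+ʳ m D (%-cong-*ˡ m c b^l≡u) ⟩
      (c * u + D) % m          ∎

  no-large-solutions : ∀ M T .{{_ : NonZero M}} .{{_ : NonZero T}} qs → isYes (certificate? M T qs) ≡ true →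
                       ∀ n l → L ≤ l → padovan n + A ≢ c * b ^ l + D
  no-large-solutions M T qs certificate n l L≤l eq with toWitness (Equivalence.from T-≡ certificate)
  ... | valid , period , covers = refuted n L≤l eq (Any.lookup covered) valid-q excludes-q
    where
    covered : Any (λ q → Excludes q (padovan n % M)) qs
    covered = subst (λ x → Any (λ q → Excludes q x) qs) (padovan-%-periodic M T period n)
                    (lookup-iterate (padovanStep (_% M)) covers (m%n<n n T))
    valid-q = proj₁ (All.lookupAny valid covered)
    excludes-q = proj₂ (All.lookupAny valid covered)

module _ (rhs : ℕ → ℕ) {S : ℕ → ℕ → Set} (S? : ∀ n l → Dec (S n l)) where

  SettledBelow : ℕ → ℕ → Set
  SettledBelow L N = ∀ {l} → l < L → 1 ≤ l →
                     rhs l < padovan′ N × (∀ {n} → n < N → padovan′ n ≡ rhs l → S n l)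

  settledBelow? : ∀ L N → Dec (SettledBelow L N)
  settledBelow? L N = allUpTo? (λ l → (1 ≤? l) →-dec ((rhs l <? padovan′ N) ×-dec
                                 allUpTo? (λ n → (padovan′ n ≟ rhs l) →-dec S? n l) N)) L

  solutions : ∀ L N → isYes (settledBelow? L N) ≡ true → (∀ n l → L ≤ l → padovan n ≢ rhs l) →
              ∀ n l → 1 ≤ l → padovan n ≡ rhs l → S n l
  solutions L N settled large n l 1≤l eq with l <? L
  ... | no  l≮L = contradiction eq (large n l (≮⇒≥ l≮L))
  ... | yes l<L = proj₂ bounded&listed n<N (trans (padovan′≡padovan n) eq)
    where
    bounded&listed = toWitness (Equivalence.from T-≡ settled) l<L 1≤l
    n<N : n < N
    n<N = ≰⇒> λ N≤n → <⇒≱ (proj₁ bounded&listed)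
                           (subst₂ _≤_ (sym (padovan′≡padovan N)) eq (padovan-mono-≤ N≤n))

∸1-shift : ∀ {x y} → 1 ≤ y → x ≡ y ∸ 1 → x + 1 ≡ y + 0
∸1-shift {y = y} 1≤y refl = trans (m∸n+n≡m 1≤y) (sym (+-identityʳ y))

-- padovan 40 = 55405 exceeds every right-hand side with l below the sieve threshold.
searchBound : ℕ
searchBound = 40

module _ {S : ℕ → ℕ → ℕ → Set} (S? : ∀ n b l → Dec (S n b l)) where

  solutions-∸1 : ∀ c b L M T .{{_ : NonZero c}} .{{_ : NonZero b}} .{{_ : NonZero M}} .{{_ : NonZero T}} qs →
                 isYes (settledBelow? (λ l → c * b ^ l ∸ 1) (λ n → S? n b) L searchBound) ≡ true →
                 isYes (Sieve.certificate? 1 0 c b L M T qs) ≡ true →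
                 ∀ n l → 1 ≤ l → padovan n ≡ c * b ^ l ∸ 1 → S n b l
  solutions-∸1 c b L M T qs settled certified = solutions _ (λ n → S? n b) L searchBound settled large
    where
    large : ∀ n l → L ≤ l → padovan n ≢ c * b ^ l ∸ 1
    large n l L≤l = Sieve.no-large-solutions 1 0 c b L M T qs certified n l L≤l
                  ∘ ∸1-shift (*-mono-≤ (>-nonZero⁻¹ c) (m^n>0 b l))

  solutions-+1 : ∀ c b L M T .{{_ : NonZero M}} .{{_ : NonZero T}} qs →
                 isYes (settledBelow? (λ l → c * b ^ l + 1) (λ n → S? n b) L searchBound) ≡ true →
                 isYes (Sieve.certificate? 0 1 c b L M T qs) ≡ true →
                 ∀ n l → 1 ≤ l → padovan n ≡ c * b ^ l + 1 → S n b l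
  solutions-+1 c b L M T qs settled certified = solutions _ (λ n → S? n b) L searchBound settled large
    where
    large : ∀ n l → L ≤ l → padovan n ≢ c * b ^ l + 1
    large n l L≤l = Sieve.no-large-solutions 0 1 c b L M T qs certified n l L≤l ∘ trans (+-identityʳ (padovan n))

Is? : ∀ n b l x y z → Dec (Is n b l x y z)
Is? n b l x y z = (n ≟ x) ×-dec (b ≟ y) ×-dec (l ≟ z)

Thabit₁Solution : ℕ → ℕ → ℕ → Set
Thabit₁Solution n b l = Is n b l 7 2 1

thabit₁Solution? : ∀ n b l → Dec (Thabit₁Solution n b l)
thabit₁Solution? n b l = Is? n b l 7 2 1

thabit₁-listed : ∀ {n b l} → Thabit₁Solution n b l → padovan n ≡ thabit₁ b l
thabit₁-listed (refl , refl , refl) = refl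

thabit₁-solutions : All (λ b → ∀ n l → 1 ≤ l → padovan n ≡ thabit₁ b l → Thabit₁Solution n b l) (applyUpTo (2 +_) 9)
thabit₁-solutions =
    solutions-∸1 thabit₁Solution? 3 2 9 229888 1792 (512 ↻ 1 ∷ 449 ↻ 224 ∷ []) refl refl
  ∷ solutions-∸1 thabit₁Solution? 4 3 2 1498491 12948 (9 ↻ 1 ∷ 166499 ↻ 166 ∷ []) refl refl
  ∷ solutions-∸1 thabit₁Solution? 5 4 5 459776 3584 (1024 ↻ 1 ∷ 449 ↻ 112 ∷ []) refl refl
  ∷ solutions-∸1 thabit₁Solution? 6 5 5 315625 15000 (3125 ↻ 1 ∷ 101 ↻ 25 ∷ []) refl refl
  ∷ solutions-∸1 thabit₁Solution? 7 6 4 6480 19656 (1296 ↻ 1 ∷ 5 ↻ 1 ∷ []) refl refl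
  ∷ solutions-∸1 thabit₁Solution? 8 7 1 112 336 (7 ↻ 1 ∷ 16 ↻ 2 ∷ []) refl refl
  ∷ solutions-∸1 thabit₁Solution? 9 8 2 488512 2016 (64 ↻ 1 ∷ 7633 ↻ 224 ∷ []) refl refl
  ∷ solutions-∸1 thabit₁Solution? 10 9 2 241461 14040 (81 ↻ 1 ∷ 2981 ↻ 15 ∷ []) refl refl
  ∷ solutions-∸1 thabit₁Solution? 11 10 1 2710 7560 (10 ↻ 1 ∷ 271 ↻ 5 ∷ []) refl refl
  ∷ []

Thabit₂Solution : ℕ → ℕ → ℕ → Set
Thabit₂Solution n b l = Is n b l 8 2 1 ⊎ Is n b l 12 4 1 ⊎ Is n b l 14 3 2 ⊎ Is n b l 15 2 4 ⊎ Is n b l 19 5 2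

thabit₂Solution? : ∀ n b l → Dec (Thabit₂Solution n b l)
thabit₂Solution? n b l = Is? n b l 8 2 1 ⊎-dec Is? n b l 12 4 1 ⊎-dec Is? n b l 14 3 2 ⊎-dec Is? n b l 15 2 4 ⊎-dec Is? n b l 19 5 2

thabit₂-listed : ∀ {n b l} → Thabit₂Solution n b l → padovan n ≡ thabit₂ b l
thabit₂-listed (inj₁ (refl , refl , refl)) = refl
thabit₂-listed (inj₂ (inj₁ (refl , refl , refl))) = refl
thabit₂-listed (inj₂ (inj₂ (inj₁ (refl , refl , refl)))) = refl
thabit₂-listed (inj₂ (inj₂ (inj₂ (inj₁ (refl , refl , refl))))) = refl
thabit₂-listed (inj₂ (inj₂ (inj₂ (inj₂ (refl , refl , refl))))) = refl

thabit₂-solutions : All (λ b → ∀ n l → 1 ≤ l → padovan n ≡ thabit₂ b l → Thabit₂Solution n b l) (applyUpTo (2 +_) 9)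
thabit₂-solutions =
    solutions-+1 thabit₂Solution? 3 2 10 459776 3584 (1024 ↻ 1 ∷ 449 ↻ 224 ∷ []) refl refl
  ∷ solutions-+1 thabit₂Solution? 4 3 5 3032991621 84240 (243 ↻ 1 ∷ 271 ↻ 30 ∷ 11 ↻ 5 ∷ 53 ↻ 52 ∷ 79 ↻ 78 ∷ 12481447 ↻ 780 ∷ []) refl refl
  ∷ solutions-+1 thabit₂Solution? 5 4 4 114944 896 (256 ↻ 1 ∷ 449 ↻ 112 ∷ []) refl refl
  ∷ solutions-+1 thabit₂Solution? 6 5 3 1375 600 (125 ↻ 1 ∷ 11 ↻ 5 ∷ []) refl refl
  ∷ solutions-+1 thabit₂Solution? 7 6 5 38880 117936 (7776 ↻ 1 ∷ 5 ↻ 1 ∷ []) refl refl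
  ∷ solutions-+1 thabit₂Solution? 8 7 1 35 48 (7 ↻ 1 ∷ 5 ↻ 4 ∷ []) refl refl
  ∷ solutions-+1 thabit₂Solution? 9 8 3 3584 5376 (512 ↻ 1 ∷ 7 ↻ 1 ∷ []) refl refl
  ∷ solutions-+1 thabit₂Solution? 10 9 2 2561301 95472 (81 ↻ 1 ∷ 31621 ↻ 17 ∷ []) refl refl
  ∷ solutions-+1 thabit₂Solution? 11 10 3 271000 37800 (1000 ↻ 1 ∷ 271 ↻ 5 ∷ []) refl refl
  ∷ []

Williams₁Solution : ℕ → ℕ → ℕ → Set
Williams₁Solution n b l = Is n b l 0 2 1 ⊎ Is n b l 1 2 1 ⊎ Is n b l 2 2 1 ⊎ Is n b l 5 2 2 ⊎ Is n b l 7 3 1 ⊎ Is n b l 8 2 3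

williams₁Solution? : ∀ n b l → Dec (Williams₁Solution n b l)
williams₁Solution? n b l = Is? n b l 0 2 1 ⊎-dec Is? n b l 1 2 1 ⊎-dec Is? n b l 2 2 1 ⊎-dec Is? n b l 5 2 2 ⊎-dec Is? n b l 7 3 1 ⊎-dec Is? n b l 8 2 3

williams₁-listed : ∀ {n b l} → Williams₁Solution n b l → padovan n ≡ williams₁ b l
williams₁-listed (inj₁ (refl , refl , refl)) = refl
williams₁-listed (inj₂ (inj₁ (refl , refl , refl))) = refl
williams₁-listed (inj₂ (inj₂ (inj₁ (refl , refl , refl)))) = refl
williams₁-listed (inj₂ (inj₂ (inj₂ (inj₁ (refl , refl , refl))))) = refl
williams₁-listed (inj₂ (inj₂ (inj₂ (inj₂ (inj₁ (refl , refl , refl)))))) = refl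
williams₁-listed (inj₂ (inj₂ (inj₂ (inj₂ (inj₂ (refl , refl , refl)))))) = refl

williams₁-solutions : All (λ b → ∀ n l → 1 ≤ l → padovan n ≡ williams₁ b l → Williams₁Solution n b l) (applyUpTo (2 +_) 9)
williams₁-solutions =
    solutions-∸1 williams₁Solution? 1 2 6 488512 2016 (64 ↻ 1 ∷ 7633 ↻ 224 ∷ []) refl refl
  ∷ solutions-∸1 williams₁Solution? 2 3 4 241461 14040 (81 ↻ 1 ∷ 2981 ↻ 30 ∷ []) refl refl
  ∷ solutions-∸1 williams₁Solution? 3 4 5 459776 3584 (1024 ↻ 1 ∷ 449 ↻ 112 ∷ []) refl refl
  ∷ solutions-∸1 williams₁Solution? 4 5 3 1375 600 (125 ↻ 1 ∷ 11 ↻ 5 ∷ []) refl refl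
  ∷ solutions-∸1 williams₁Solution? 5 6 2 1548 6006 (36 ↻ 1 ∷ 43 ↻ 3 ∷ []) refl refl
  ∷ solutions-∸1 williams₁Solution? 6 7 3 302869 7056 (343 ↻ 1 ∷ 883 ↻ 98 ∷ []) refl refl
  ∷ solutions-∸1 williams₁Solution? 7 8 1 280 336 (8 ↻ 1 ∷ 35 ↻ 4 ∷ []) refl refl
  ∷ solutions-∸1 williams₁Solution? 8 9 2 417069 7020 (81 ↻ 1 ∷ 5149 ↻ 45 ∷ []) refl refl
  ∷ solutions-∸1 williams₁Solution? 9 10 1 110 840 (10 ↻ 1 ∷ 11 ↻ 2 ∷ []) refl refl
  ∷ []

Williams₂Solution : ℕ → ℕ → ℕ → Set
Williams₂Solution n b l = Is n b l 5 2 1 ⊎ Is n b l 7 2 2 ⊎ Is n b l 8 3 1 ⊎ Is n b l 9 2 3 ⊎ Is n b l 12 5 1 ⊎ Is n b l 15 4 2 ⊎ Is n b l 16 2 6 ⊎ Is n b l 26 6 3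

williams₂Solution? : ∀ n b l → Dec (Williams₂Solution n b l)
williams₂Solution? n b l = Is? n b l 5 2 1 ⊎-dec Is? n b l 7 2 2 ⊎-dec Is? n b l 8 3 1 ⊎-dec Is? n b l 9 2 3 ⊎-dec Is? n b l 12 5 1 ⊎-dec Is? n b l 15 4 2 ⊎-dec Is? n b l 16 2 6 ⊎-dec Is? n b l 26 6 3

williams₂-listed : ∀ {n b l} → Williams₂Solution n b l → padovan n ≡ williams₂ b l
williams₂-listed (inj₁ (refl , refl , refl)) = refl
williams₂-listed (inj₂ (inj₁ (refl , refl , refl))) = refl
williams₂-listed (inj₂ (inj₂ (inj₁ (refl , refl , refl)))) = refl
williams₂-listed (inj₂ (inj₂ (inj₂ (inj₁ (refl , refl , refl))))) = refl
williams₂-listed (inj₂ (inj₂ (inj₂ (inj₂ (inj₁ (refl , refl , refl)))))) = refl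
williams₂-listed (inj₂ (inj₂ (inj₂ (inj₂ (inj₂ (inj₁ (refl , refl , refl))))))) = refl
williams₂-listed (inj₂ (inj₂ (inj₂ (inj₂ (inj₂ (inj₂ (inj₁ (refl , refl , refl)))))))) = refl
williams₂-listed (inj₂ (inj₂ (inj₂ (inj₂ (inj₂ (inj₂ (inj₂ (refl , refl , refl)))))))) = refl

williams₂-solutions : All (λ b → ∀ n l → 1 ≤ l → padovan n ≡ williams₂ b l → Williams₂Solution n b l) (applyUpTo (2 +_) 9)
williams₂-solutions =
    solutions-+1 williams₂Solution? 1 2 10 459776 3584 (1024 ↻ 1 ∷ 449 ↻ 224 ∷ []) refl refl
  ∷ solutions-+1 williams₂Solution? 2 3 5 65260323 115830 (243 ↻ 1 ∷ 271 ↻ 30 ∷ 991 ↻ 330 ∷ 268561 ↻ 330 ∷ []) refl refl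
  ∷ solutions-+1 williams₂Solution? 3 4 5 459776 3584 (1024 ↻ 1 ∷ 449 ↻ 112 ∷ []) refl refl
  ∷ solutions-+1 williams₂Solution? 4 5 3 1375 600 (125 ↻ 1 ∷ 11 ↻ 5 ∷ []) refl refl
  ∷ solutions-+1 williams₂Solution? 5 6 5 2884896 117936 (7776 ↻ 1 ∷ 7 ↻ 2 ∷ 53 ↻ 26 ∷ 371 ↻ 26 ∷ []) refl refl
  ∷ solutions-+1 williams₂Solution? 6 7 1 35 48 (7 ↻ 1 ∷ 5 ↻ 4 ∷ []) refl refl
  ∷ solutions-+1 williams₂Solution? 7 8 4 1839104 14336 (4096 ↻ 1 ∷ 449 ↻ 224 ∷ []) refl refl
  ∷ solutions-+1 williams₂Solution? 8 9 3 3753621 63180 (729 ↻ 1 ∷ 19 ↻ 9 ∷ 271 ↻ 15 ∷ 5149 ↻ 45 ∷ []) refl refl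
  ∷ solutions-+1 williams₂Solution? 9 10 3 11000 4200 (1000 ↻ 1 ∷ 11 ↻ 2 ∷ []) refl refl
  ∷ []

theorem3p1 : (n b l : ℕ) → 2 ≤ b → b ≤ 10 → 1 ≤ l →
      ((padovan n ≡ thabit₁ b l → Is n b l 7 2 1)
         × (Is n b l 7 2 1 → padovan n ≡ thabit₁ b l))
    × ((padovan n ≡ thabit₂ b l →
          Is n b l 8 2 1 ⊎ Is n b l 12 4 1 ⊎ Is n b l 14 3 2 ⊎ Is n b l 15 2 4 ⊎ Is n b l 19 5 2)
         × (Is n b l 8 2 1 ⊎ Is n b l 12 4 1 ⊎ Is n b l 14 3 2 ⊎ Is n b l 15 2 4 ⊎ Is n b l 19 5 2 →
          padovan n ≡ thabit₂ b l))
    × ((padovan n ≡ williams₁ b l →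
          Is n b l 0 2 1 ⊎ Is n b l 1 2 1 ⊎ Is n b l 2 2 1 ⊎ Is n b l 5 2 2 ⊎ Is n b l 7 3 1 ⊎ Is n b l 8 2 3)
         × (Is n b l 0 2 1 ⊎ Is n b l 1 2 1 ⊎ Is n b l 2 2 1 ⊎ Is n b l 5 2 2 ⊎ Is n b l 7 3 1 ⊎ Is n b l 8 2 3 →
          padovan n ≡ williams₁ b l))
    × ((padovan n ≡ williams₂ b l →
          Is n b l 5 2 1 ⊎ Is n b l 7 2 2 ⊎ Is n b l 8 3 1 ⊎ Is n b l 9 2 3 ⊎ Is n b l 12 5 1 ⊎ Is n b l 15 4 2 ⊎ Is n b l 16 2 6 ⊎ Is n b l 26 6 3)
         × (Is n b l 5 2 1 ⊎ Is n b l 7 2 2 ⊎ Is n b l 8 3 1 ⊎ Is n b l 9 2 3 ⊎ Is n b l 12 5 1 ⊎ Is n b l 15 4 2 ⊎ Is n b l 16 2 6 ⊎ Is n b l 26 6 3 →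
          padovan n ≡ williams₂ b l))
theorem3p1 n b l 2≤b b≤10 1≤l =
    (atBase thabit₁-solutions n l 1≤l , thabit₁-listed)
  , (atBase thabit₂-solutions n l 1≤l , thabit₂-listed)
  , (atBase williams₁-solutions n l 1≤l , williams₁-listed)
  , (atBase williams₂-solutions n l 1≤l , williams₂-listed)
  where
  atBase : ∀ {P : ℕ → Set} → All P (applyUpTo (2 +_) 9) → P b
  atBase ps = lookup-between ps 2≤b (s≤s b≤10)
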